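{- Let $G$ be a finite simple graph and let $P=(x,v_1,\dots,v_s,y)$ (with $s\ge 0$) be a binary path in $G$ with at least two vertices. Let $H=G-\{v_1,\dots,v_s\}$. If $H$ has an $(x,y)$-nice $(2r+1,r)$-configuration, then $G$ has a $(2r+1,r)$-configuration.
   Context: A path in $G$ is binary if all its internal (non-end) vertices have degree $2$ in $G$. A set $D$ is dominating if every vertex not in $D$ has a neighbour in $D$. A $(k,s)$-configuration of a graph is a multiset of $k$ (not necessarily distinct) dominating sets such that every vertex lies in at most $s$ of them. For a multiset $\mathcal D$ of dominating sets and distinct vertices $x,y$, let $\mathcal D_x=\{D\in\mathcal D: x\in D, y\notin D\}$, $\mathcal D_y=\{D\in\mathcal D: y\in D, x\notin D\}$, $\mathcal D_{xy}=\{D\in\mathcal D: x,y\in D\}$ (as multisets). A $(2r+1,r)$-configuration $\mathcal D$ is $(x,y)$-nice if each of $x$ and $y$ belongs to exactly $r$ sets of $\mathcal D$, and $\mathcal D_x$, $\mathcal D_y$, $\mathcal D_{xy}$ are all nonempty. -}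

module Defs where

open import Data.Nat using (ℕ; _≤_)
open import Data.Bool using (Bool; true; false; not)
open import Data.Fin using (Fin; _≟_)
open import Data.Fin.Subset using (Subset; _∈_; _∉_; _⊆_; ∣_∣)
open import Data.Vec using (tabulate)
open import Data.List using (List; _∷_; []; _++_)
open import Data.List.Relation.Unary.All using (All)
open import Data.List.Relation.Unary.Linked using (Linked)
open import Data.List.Relation.Unary.Unique.Propositional using (Unique)
import Data.List.Membership.DecPropositional as DecMem
open import Data.Product using (Σ; _×_)
open import Relation.Binary.PropositionalEquality using (_≡_)
open import Relation.Nullary.Decidable using (⌊_⌋)

record SimpleGraph (n : ℕ) : Set where
  field
    adj    : Fin n → Fin n → Bool
    sym    : ∀ u v → adj u v ≡ adj v u
    irrefl : ∀ u → adj u u ≡ false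

open SimpleGraph public

Adj : ∀ {n} → SimpleGraph n → Fin n → Fin n → Set
Adj G u v = adj G u v ≡ true

degree : ∀ {n} → SimpleGraph n → Fin n → ℕ
degree G u = ∣ tabulate (adj G u) ∣

IsPath : ∀ {n} → SimpleGraph n → List (Fin n) → Set
IsPath G ps = Unique ps × Linked (Adj G) ps

IsBinaryPath : ∀ {n} → SimpleGraph n → Fin n → List (Fin n) → Fin n → Set
IsBinaryPath G x vs y =
  IsPath G (x ∷ vs ++ y ∷ []) × All (λ v → degree G v ≡ 2) vs

removeVertices : ∀ {n} → List (Fin n) → Subset n
removeVertices vs = tabulate (λ u → not ⌊ u ∈? vs ⌋)
  where open DecMem _≟_

-- D is a dominating set of the induced subgraph G[V]:
-- D ⊆ V and every vertex of V not in D has a neighbour in D.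
-- (G itself is G[⊤]; G - S is G[removeVertices S].)
Dominating : ∀ {n} → SimpleGraph n → Subset n → Subset n → Set
Dominating G V D =
  D ⊆ V × (∀ u → u ∈ V → u ∉ D → Σ (Fin _) λ w → w ∈ D × Adj G u w)

-- A multiset of k subsets, given as a k-indexed family.
Family : ℕ → ℕ → Set
Family k n = Fin k → Subset n

multiplicity : ∀ {k n} → Family k n → Fin n → ℕ
multiplicity {k} 𝒟 u = ∣ tabulate (λ i → Data.Vec.lookup (𝒟 i) u) ∣
  where import Data.Vec

IsConfiguration : ∀ {n} → SimpleGraph n → Subset n → (k s : ℕ) → Family k n → Set
IsConfiguration G V k s 𝒟 =
  (∀ i → Dominating G V (𝒟 i)) × (∀ u → multiplicity 𝒟 u ≤ s)

HasConfiguration : ∀ {n} → SimpleGraph n → Subset n → (k s : ℕ) → Set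
HasConfiguration {n} G V k s = Σ (Family k n) (IsConfiguration G V k s)

IsNice : ∀ {n} → SimpleGraph n → Subset n → (r : ℕ) → Fin n → Fin n →
         Family (2 Data.Nat.* r Data.Nat.+ 1) n → Set
IsNice G V r x y 𝒟 =
  IsConfiguration G V (2 Data.Nat.* r Data.Nat.+ 1) r 𝒟 ×
  multiplicity 𝒟 x ≡ r × multiplicity 𝒟 y ≡ r ×
  Σ (Fin _) (λ i → x ∈ 𝒟 i × y ∉ 𝒟 i) ×
  Σ (Fin _) (λ i → y ∈ 𝒟 i × x ∉ 𝒟 i) ×
  Σ (Fin _) (λ i → x ∈ 𝒟 i × y ∈ 𝒟 i)
  where import Data.Nat

-- Choose three classes of indices of the sets D i, one per residue mod 3, together
-- covering all 2r+1 indices, and let the j-th vertex of the path (x being the 0th) join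
-- D i exactly when i lies in the class of j mod 3.  Then every three consecutive path
-- vertices meet every D i, so the internal vertices are dominated, and an internal vertex
-- lies in as many sets as its class has members.  The ends x and y keep their old
-- memberships; this costs nothing if the class of 0 only contains indices of sets
-- containing x and the class of s+1 only indices of sets containing y.  With X and Y the
-- index sets of the sets containing x and y (each of size r), niceness provides such
-- classes of size at most r: X, Y and ∁Y ─ X when s+1 ≢ 0 (mod 3), and otherwise
-- X ∩ Y, (X ─ Y) ∪ {c} and ∁X − c for some c ∉ X.
module Submission where

open import Defs hiding (sym)
open import Data.Nat using (ℕ; zero; suc; _+_; _*_; _∸_; _≤_; z≤n; s≤s)
open import Data.Nat.Properties
  using (≤-trans; ≤-reflexive; ≤-pred; +-assoc; +-comm; +-suc; +-identityʳ;
         +-monoʳ-≤; n≤1+n; m+n∸m≡n; module ≤-Reasoning)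
open import Data.Bool using (Bool; true; false; not; if_then_else_)
import Data.Bool as Bool
import Data.Bool.Properties as Boolₚ
open import Data.Fin using (Fin; _≟_)
open import Data.Fin.Subset
  using (Subset; ⊤; _∈_; _∉_; _⊆_; ∣_∣; ∁; _∩_; _∪_; _─_; _-_; ⁅_⁆; inside; outside)
open import Data.Fin.Subset.Properties
  using (_∈?_; ∈⊤; ⊆-refl; ∣∁p∣≡n∸∣p∣; ∣p∩q∣≤∣p∣; ∣⁅x⁆∣≡1; x∈⁅x⁆; x∉p⇒x∈∁p;
         x∈p∩q⁺; x∈p∩q⁻; x∈p∪q⁺; x∈p∧x∉q⇒x∈p─q; x∈p∧x≢y⇒x∈p-y;
         p∩q≢∅⇒∣p─q∣<∣p∣; x∈p⇒∣p-x∣<∣p∣)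
open import Data.Vec using ([]; _∷_; tabulate; lookup)
open import Data.Vec.Properties
  using (lookup∘tabulate; tabulate∘lookup; tabulate-cong; []=⇒lookup; lookup⇒[]=)
open import Data.List using (List; []; _∷_; _++_; map; length; applyUpTo)
open import Data.List.Properties using (map-++; map-cong-local; applyUpTo-∷ʳ)
open import Data.List.Relation.Unary.All as All using ([]; _∷_)
open import Data.List.Relation.Unary.All.Properties using (++⁻ˡ; ++⁻ʳ)
open import Data.List.Relation.Unary.Any using (here; there)
open import Data.List.Relation.Unary.Linked using (Linked; _∷_)
open import Data.List.Relation.Unary.AllPairs as AllPairs using ([]; _∷_)
open import Data.List.Relation.Unary.Unique.Propositional using (Unique)
open import Data.List.Relation.Unary.Unique.Propositional.Properties
  using (Unique[x∷xs]⇒x∉xs)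
open import Data.List.Relation.Binary.Pointwise as Pointwise using (Pointwise; _∷_; [])
open import Data.List.Membership.Propositional using () renaming (_∈_ to _∈ˡ_; _∉_ to _∉ˡ_)
open import Data.List.Membership.Propositional.Properties using (∈-++⁺ˡ)
import Data.List.Membership.DecPropositional as DecMembership
open import Data.Product using (Σ; ∃-syntax; _×_; _,_; proj₁; proj₂)
open import Data.Sum using (_⊎_; inj₁; inj₂; [_,_]; [_,_]′)
open import Data.Unit using (tt) renaming (⊤ to Unit)
open import Data.Empty using (⊥-elim)
open import Function using (_∘_)
open import Relation.Nullary using (Dec; yes; no; does)
open import Relation.Nullary.Decidable using (dec-true; dec-false; isYes≗does; toSum)
open import Relation.Binary.PropositionalEquality
  using (_≡_; _≢_; refl; sym; trans; cong; cong₂; subst₂)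

_∈ˡ?_ : ∀ {n} (u : Fin n) (vs : List (Fin n)) → Dec (u ∈ˡ vs)
_∈ˡ?_ {n} = DecMembership._∈?_ (_≟_ {n})

∣p∪q∣≤∣p∣+∣q∣ : ∀ {m} (p q : Subset m) → ∣ p ∪ q ∣ ≤ ∣ p ∣ + ∣ q ∣
∣p∪q∣≤∣p∣+∣q∣ []            []            = z≤n
∣p∪q∣≤∣p∣+∣q∣ (outside ∷ p) (outside ∷ q) = ∣p∪q∣≤∣p∣+∣q∣ p q
∣p∪q∣≤∣p∣+∣q∣ (outside ∷ p) (inside  ∷ q) =
  ≤-trans (s≤s (∣p∪q∣≤∣p∣+∣q∣ p q)) (≤-reflexive (sym (+-suc ∣ p ∣ ∣ q ∣)))
∣p∪q∣≤∣p∣+∣q∣ (inside  ∷ p) (outside ∷ q) = s≤s (∣p∪q∣≤∣p∣+∣q∣ p q)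
∣p∪q∣≤∣p∣+∣q∣ (inside  ∷ p) (inside  ∷ q) =
  s≤s (≤-trans (∣p∪q∣≤∣p∣+∣q∣ p q) (+-monoʳ-≤ ∣ p ∣ (n≤1+n ∣ q ∣)))

⊆⇒lookup≤ : ∀ {m} {p q : Subset m} → p ⊆ q → ∀ i → lookup p i Bool.≤ lookup q i
⊆⇒lookup≤ {p = p} {q} p⊆q i with lookup p i in eq
... | false = Boolₚ.≤-minimum (lookup q i)
... | true  = Boolₚ.≤-reflexive (sym ([]=⇒lookup (p⊆q (lookup⇒[]= i p eq))))

-- multiplicity 𝒟 u is ∣ column 𝒟 u ∣ by definition.
column : ∀ {k n} → Family k n → Fin n → Subset k
column 𝒟 u = tabulate (λ i → lookup (𝒟 i) u)

∈-column⁺ : ∀ {k n} (𝒟 : Family k n) {i u} → u ∈ 𝒟 i → i ∈ column 𝒟 u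
∈-column⁺ 𝒟 {i} {u} u∈ =
  lookup⇒[]= i (column 𝒟 u) (trans (lookup∘tabulate _ i) ([]=⇒lookup u∈))

∉-column⁺ : ∀ {k n} (𝒟 : Family k n) {i u} → u ∉ 𝒟 i → i ∉ column 𝒟 u
∉-column⁺ 𝒟 {i} {u} u∉ i∈ =
  u∉ (lookup⇒[]= u (𝒟 i) (trans (sym (lookup∘tabulate _ i)) ([]=⇒lookup i∈)))

lookup-removeVertices : ∀ {n} (vs : List (Fin n)) u →
                        lookup (removeVertices vs) u ≡ not (does (u ∈ˡ? vs))
lookup-removeVertices vs u = trans (lookup∘tabulate _ u) (cong not (isYes≗does (u ∈ˡ? vs)))

∈-removeVertices⁺ : ∀ {n} {vs : List (Fin n)} {u} → u ∉ˡ vs → u ∈ removeVertices vs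
∈-removeVertices⁺ {vs = vs} {u} u∉ =
  lookup⇒[]= u (removeVertices vs)
    (trans (lookup-removeVertices vs u) (cong not (dec-false (u ∈ˡ? vs) u∉)))

∈-removeVertices⁻ : ∀ {n} {vs : List (Fin n)} {u} → u ∈ removeVertices vs → u ∉ˡ vs
∈-removeVertices⁻ {vs = vs} {u} u∈ u∈vs
  with trans (sym ([]=⇒lookup u∈))
             (trans (lookup-removeVertices vs u) (cong not (dec-true (u ∈ˡ? vs) u∈vs)))
... | ()

Unique-∷ʳ⁻ : ∀ {A : Set} {xs : List A} {y} → Unique (xs ++ y ∷ []) → Unique xs × y ∉ˡ xs
Unique-∷ʳ⁻ {xs = []}     _            = [] , λ ()
Unique-∷ʳ⁻ {xs = x ∷ xs} (x≢ ∷ uniq) = (++⁻ˡ xs x≢ ∷ proj₁ ih) , y∉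
  where
  ih = Unique-∷ʳ⁻ uniq
  y∉ : _ ∉ˡ x ∷ xs
  y∉ (here refl) with ++⁻ʳ xs x≢
  ... | x≢x ∷ [] = x≢x refl
  y∉ (there y∈) = proj₂ ih y∈

position : ∀ {n} → Fin n → List (Fin n) → ℕ
position u []       = 0
position u (v ∷ vs) = if does (u ≟ v) then 0 else suc (position u vs)

map-position : ∀ {n} {A : Set} (h : ℕ → A) {vs : List (Fin n)} → Unique vs →
               map (λ u → h (position u vs)) vs ≡ applyUpTo h (length vs)
map-position h {[]}     []          = refl
map-position h {v ∷ vs} (v≢ ∷ uniq) =
  cong₂ _∷_ (cong (λ b → h (if b then 0 else suc (position v vs))) (dec-true (v ≟ v) refl))
            (trans (map-cong-local (All.map shift v≢)) (map-position (h ∘ suc) uniq))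
  where
  shift : ∀ {u} → v ≢ u → h (position u (v ∷ vs)) ≡ h (suc (position u vs))
  shift {u} v≢u =
    cong (λ b → h (if b then 0 else suc (position u vs))) (dec-false (u ≟ v) (v≢u ∘ sym))

data Phase : Set where
  φ₀ φ₁ φ₂ : Phase

next : Phase → Phase
next φ₀ = φ₁
next φ₁ = φ₂
next φ₂ = φ₀

phase : ℕ → Phase
phase zero    = φ₀
phase (suc j) = next (phase j)

among-three-consecutive : ∀ τ σ → σ ≡ τ ⊎ σ ≡ next τ ⊎ σ ≡ next (next τ)
among-three-consecutive φ₀ φ₀ = inj₁ refl
among-three-consecutive φ₀ φ₁ = inj₂ (inj₁ refl)
among-three-consecutive φ₀ φ₂ = inj₂ (inj₂ refl)
among-three-consecutive φ₁ φ₀ = inj₂ (inj₂ refl)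
among-three-consecutive φ₁ φ₁ = inj₁ refl
among-three-consecutive φ₁ φ₂ = inj₂ (inj₁ refl)
among-three-consecutive φ₂ φ₀ = inj₂ (inj₁ refl)
among-three-consecutive φ₂ φ₁ = inj₂ (inj₂ refl)
among-three-consecutive φ₂ φ₂ = inj₁ refl

AnyTrue₃ : Bool → Bool → Bool → Set
AnyTrue₃ a b c = a ≡ true ⊎ b ≡ true ⊎ c ≡ true

MeetsEveryTriple : List Bool → Set
MeetsEveryTriple (a ∷ b ∷ c ∷ bs) = AnyTrue₃ a b c × MeetsEveryTriple (b ∷ c ∷ bs)
MeetsEveryTriple _                = Unit

≤-true : ∀ {a b} → a Bool.≤ b → a ≡ true → b ≡ true
≤-true Bool.b≤b refl = refl

AnyTrue₃-mono : ∀ {a b c a′ b′ c′} → a Bool.≤ a′ → b Bool.≤ b′ → c Bool.≤ c′ →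
                AnyTrue₃ a b c → AnyTrue₃ a′ b′ c′
AnyTrue₃-mono a≤ b≤ c≤ =
  [ inj₁ ∘ ≤-true a≤ , [ inj₂ ∘ inj₁ ∘ ≤-true b≤ , inj₂ ∘ inj₂ ∘ ≤-true c≤ ] ]

meetsEveryTriple-mono : ∀ {as bs} → Pointwise Bool._≤_ as bs →
                        MeetsEveryTriple as → MeetsEveryTriple bs
meetsEveryTriple-mono []                   _        = tt
meetsEveryTriple-mono (_ ∷ [])             _        = tt
meetsEveryTriple-mono (_ ∷ _ ∷ [])         _        = tt
meetsEveryTriple-mono (a≤ ∷ b≤ ∷ c≤ ∷ ≤s) (w , ws) =
  AnyTrue₃-mono a≤ b≤ c≤ w , meetsEveryTriple-mono (b≤ ∷ c≤ ∷ ≤s) ws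

applyUpTo-meetsEveryTriple : (f : ℕ → Bool) →
  (∀ j → AnyTrue₃ (f j) (f (suc j)) (f (suc (suc j)))) →
  ∀ L → MeetsEveryTriple (applyUpTo f L)
applyUpTo-meetsEveryTriple f w zero                = tt
applyUpTo-meetsEveryTriple f w (suc zero)          = tt
applyUpTo-meetsEveryTriple f w (suc (suc zero))    = tt
applyUpTo-meetsEveryTriple f w (suc (suc (suc L))) =
  w 0 , applyUpTo-meetsEveryTriple (f ∘ suc) (w ∘ suc) (suc (suc L))

record PhaseCover {k} (s : ℕ) (X Y : Subset k) (e : Phase) : Set where
  field
    class    : Phase → Subset k
    covers   : ∀ i → ∃[ σ ] i ∈ class σ
    class₀⊆X : class φ₀ ⊆ X
    classₑ⊆Y : class e ⊆ Y
    small    : ∀ σ → ∣ class σ ∣ ≤ s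

  window : ∀ i j → AnyTrue₃ (lookup (class (phase j)) i)
                            (lookup (class (phase (suc j))) i)
                            (lookup (class (phase (suc (suc j)))) i)
  window i j with covers i
  ... | σ , i∈ with among-three-consecutive (phase j) σ
  ...   | inj₁ refl        = inj₁ ([]=⇒lookup i∈)
  ...   | inj₂ (inj₁ refl) = inj₂ (inj₁ ([]=⇒lookup i∈))
  ...   | inj₂ (inj₂ refl) = inj₂ (inj₂ ([]=⇒lookup i∈))

∣∁p∣≡1+r : ∀ {r} (p : Subset (2 * r + 1)) → ∣ p ∣ ≡ r → ∣ ∁ p ∣ ≡ suc r
∣∁p∣≡1+r {r} p ∣p∣≡r =
  trans (∣∁p∣≡n∸∣p∣ p) (trans (cong₂ _∸_ 2r+1≡r+1+r ∣p∣≡r) (m+n∸m≡n r (suc r)))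
  where
  2r+1≡r+1+r : 2 * r + 1 ≡ r + suc r
  2r+1≡r+1+r = trans (+-assoc r (r + 0) 1)
                     (cong (r +_) (trans (cong (_+ 1) (+-identityʳ r)) (+-comm r 1)))

module _ {r} {X Y : Subset (2 * r + 1)} (∣X∣≡r : ∣ X ∣ ≡ r) (∣Y∣≡r : ∣ Y ∣ ≡ r)
         {a b c} (a∈X : a ∈ X) (a∉Y : a ∉ Y) (b∈X : b ∈ X) (b∈Y : b ∈ Y) (c∉X : c ∉ X)
  where

  private
    ∣X∩Y∣≤r : ∣ X ∩ Y ∣ ≤ r
    ∣X∩Y∣≤r = ≤-trans (∣p∩q∣≤∣p∣ X Y) (≤-reflexive ∣X∣≡r)

    ∣X─Y∪c∣≤r : ∣ (X ─ Y) ∪ ⁅ c ⁆ ∣ ≤ r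
    ∣X─Y∪c∣≤r = begin
      ∣ (X ─ Y) ∪ ⁅ c ⁆ ∣     ≤⟨ ∣p∪q∣≤∣p∣+∣q∣ (X ─ Y) ⁅ c ⁆ ⟩
      ∣ X ─ Y ∣ + ∣ ⁅ c ⁆ ∣   ≡⟨ cong (∣ X ─ Y ∣ +_) (∣⁅x⁆∣≡1 c) ⟩
      ∣ X ─ Y ∣ + 1           ≡⟨ +-comm ∣ X ─ Y ∣ 1 ⟩
      suc ∣ X ─ Y ∣           ≤⟨ p∩q≢∅⇒∣p─q∣<∣p∣ X Y (b , x∈p∩q⁺ (b∈X , b∈Y)) ⟩
      ∣ X ∣                   ≡⟨ ∣X∣≡r ⟩
      r                       ∎
      where open ≤-Reasoning

    ∣∁X-c∣≤r : ∣ ∁ X - c ∣ ≤ r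
    ∣∁X-c∣≤r = ≤-pred (≤-trans (x∈p⇒∣p-x∣<∣p∣ (x∉p⇒x∈∁p c∉X))
                              (≤-reflexive (∣∁p∣≡1+r X ∣X∣≡r)))

    ∣∁Y─X∣≤r : ∣ ∁ Y ─ X ∣ ≤ r
    ∣∁Y─X∣≤r = ≤-pred (≤-trans (p∩q≢∅⇒∣p─q∣<∣p∣ (∁ Y) X (a , x∈p∩q⁺ (x∉p⇒x∈∁p a∉Y , a∈X)))
                              (≤-reflexive (∣∁p∣≡1+r Y ∣Y∣≡r)))

    class₀ : Phase → Subset (2 * r + 1)
    class₀ φ₀ = X ∩ Y
    class₀ φ₁ = (X ─ Y) ∪ ⁅ c ⁆
    class₀ φ₂ = ∁ X - c

    covers₀ : ∀ i → ∃[ σ ] i ∈ class₀ σ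
    covers₀ i with i ∈? X | i ∈? Y | i ≟ c
    ... | yes i∈X | yes i∈Y | _        = φ₀ , x∈p∩q⁺ (i∈X , i∈Y)
    ... | yes i∈X | no  i∉Y | _        = φ₁ , x∈p∪q⁺ (inj₁ (x∈p∧x∉q⇒x∈p─q i∈X i∉Y))
    ... | no  _   | _       | yes refl = φ₁ , x∈p∪q⁺ (inj₂ (x∈⁅x⁆ c))
    ... | no  i∉X | _       | no  i≢c  = φ₂ , x∈p∧x≢y⇒x∈p-y (x∉p⇒x∈∁p i∉X) i≢c

    X∪Y∪∁Y─X : ∀ i → i ∈ X ⊎ i ∈ Y ⊎ i ∈ ∁ Y ─ X
    X∪Y∪∁Y─X i with i ∈? X | i ∈? Y
    ... | yes i∈X | _       = inj₁ i∈X
    ... | no  _   | yes i∈Y = inj₂ (inj₁ i∈Y)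
    ... | no  i∉X | no  i∉Y = inj₂ (inj₂ (x∈p∧x∉q⇒x∈p─q (x∉p⇒x∈∁p i∉Y) i∉X))

    class₁ : Phase → Subset (2 * r + 1)
    class₁ φ₀ = X
    class₁ φ₁ = Y
    class₁ φ₂ = ∁ Y ─ X

    class₂ : Phase → Subset (2 * r + 1)
    class₂ φ₀ = X
    class₂ φ₁ = ∁ Y ─ X
    class₂ φ₂ = Y

    covers₁ : ∀ i → ∃[ σ ] i ∈ class₁ σ
    covers₁ = [ (φ₀ ,_) , [ (φ₁ ,_) , (φ₂ ,_) ]′ ]′ ∘ X∪Y∪∁Y─X

    covers₂ : ∀ i → ∃[ σ ] i ∈ class₂ σ
    covers₂ = [ (φ₀ ,_) , [ (φ₂ ,_) , (φ₁ ,_) ]′ ]′ ∘ X∪Y∪∁Y─X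

  phaseCover : ∀ e → PhaseCover r X Y e
  phaseCover φ₀ = record
    { class    = class₀
    ; covers   = covers₀
    ; class₀⊆X = proj₁ ∘ x∈p∩q⁻ X Y
    ; classₑ⊆Y = proj₂ ∘ x∈p∩q⁻ X Y
    ; small    = λ { φ₀ → ∣X∩Y∣≤r ; φ₁ → ∣X─Y∪c∣≤r ; φ₂ → ∣∁X-c∣≤r }
    }
  phaseCover φ₁ = record
    { class    = class₁
    ; covers   = covers₁
    ; class₀⊆X = ⊆-refl
    ; classₑ⊆Y = ⊆-refl
    ; small    = λ { φ₀ → ≤-reflexive ∣X∣≡r ; φ₁ → ≤-reflexive ∣Y∣≡r ; φ₂ → ∣∁Y─X∣≤r }
    }
  phaseCover φ₂ = record
    { class    = class₂
    ; covers   = covers₂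
    ; class₀⊆X = ⊆-refl
    ; classₑ⊆Y = ⊆-refl
    ; small    = λ { φ₀ → ≤-reflexive ∣X∣≡r ; φ₁ → ∣∁Y─X∣≤r ; φ₂ → ≤-reflexive ∣Y∣≡r }
    }

module _ {n} (G : SimpleGraph n) (S : Subset n) where

  neighbour-in-window : ∀ {a b c} → AnyTrue₃ (lookup S a) (lookup S b) (lookup S c) →
                        b ∉ S → Adj G a b → Adj G b c → ∃[ w ] w ∈ S × Adj G b w
  neighbour-in-window {a}     (inj₁ a∈)        _  ab _  =
    a , lookup⇒[]= a S a∈ , trans (SimpleGraph.sym G _ a) ab
  neighbour-in-window {b = b} (inj₂ (inj₁ b∈)) b∉ _  _  = ⊥-elim (b∉ (lookup⇒[]= b S b∈))
  neighbour-in-window {c = c} (inj₂ (inj₂ c∈)) _  _  bc = c , lookup⇒[]= c S c∈ , bc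

  interior-dominated : ∀ p vs q → Linked (Adj G) (p ∷ vs ++ q ∷ []) →
                       MeetsEveryTriple (map (lookup S) (p ∷ vs ++ q ∷ [])) →
                       ∀ {u} → u ∈ˡ vs → u ∉ S → ∃[ w ] w ∈ S × Adj G u w
  interior-dominated p (v ∷ [])      q (pv ∷ vq ∷ _) (w , _) (here refl) v∉ =
    neighbour-in-window w v∉ pv vq
  interior-dominated p (v ∷ v′ ∷ vs) q (pv ∷ vv′ ∷ _) (w , _) (here refl) v∉ =
    neighbour-in-window w v∉ pv vv′
  interior-dominated p (v ∷ v′ ∷ vs) q (_ ∷ path) (_ , ws) (there u∈) u∉ =
    interior-dominated v (v′ ∷ vs) q path ws u∈ u∉

module Extension {n k s} (G : SimpleGraph n) {x y : Fin n} (vs : List (Fin n))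
                 (path : IsPath G (x ∷ vs ++ y ∷ []))
                 {D : Family k n} (config : IsConfiguration G (removeVertices vs) k s D)
                 (cover : PhaseCover s (column D x) (column D y) (phase (suc (length vs))))
  where

  open PhaseCover cover

  phaseOf : Fin n → Phase
  phaseOf u = phase (suc (position u vs))

  member : Fin k → Fin n → Bool → Bool
  member i u onPath = if onPath then lookup (class (phaseOf u)) i else lookup (D i) u

  extended : Family k n
  extended i = tabulate (λ u → member i u (does (u ∈ˡ? vs)))

  private
    uniq-vs : Unique vs
    uniq-vs = proj₁ (Unique-∷ʳ⁻ (AllPairs.tail (proj₁ path)))

    x∉vs : x ∉ˡ vs
    x∉vs = Unique[x∷xs]⇒x∉xs (proj₁ path) ∘ ∈-++⁺ˡ

    y∉vs : y ∉ˡ vs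
    y∉vs = proj₂ (Unique-∷ʳ⁻ (AllPairs.tail (proj₁ path)))

  lookup-extended-on : ∀ i {u} → u ∈ˡ vs → lookup (extended i) u ≡ lookup (class (phaseOf u)) i
  lookup-extended-on i {u} u∈ =
    trans (lookup∘tabulate _ u) (cong (member i u) (dec-true (u ∈ˡ? vs) u∈))

  lookup-extended-off : ∀ i {u} → u ∉ˡ vs → lookup (extended i) u ≡ lookup (D i) u
  lookup-extended-off i {u} u∉ =
    trans (lookup∘tabulate _ u) (cong (member i u) (dec-false (u ∈ˡ? vs) u∉))

  ∈-extended-off : ∀ {i u} → u ∉ˡ vs → u ∈ D i → u ∈ extended i
  ∈-extended-off {i} {u} u∉ u∈ =
    lookup⇒[]= u (extended i) (trans (lookup-extended-off i u∉) ([]=⇒lookup u∈))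

  multiplicity-extended : ∀ u → multiplicity extended u ≤ s
  multiplicity-extended u with u ∈ˡ? vs
  ... | yes u∈ = ≤-trans (≤-reflexive (cong ∣_∣ column≡class)) (small _)
    where
    column≡class : column extended u ≡ class (phaseOf u)
    column≡class = trans (tabulate-cong (λ i → lookup-extended-on i u∈)) (tabulate∘lookup _)
  ... | no u∉ =
    ≤-trans (≤-reflexive (cong ∣_∣ (tabulate-cong (λ i → lookup-extended-off i u∉))))
            (proj₂ config u)

  pattern≤extended : ∀ i →
    Pointwise Bool._≤_ (applyUpTo (λ j → lookup (class (phase j)) i) (suc (suc (length vs))))
                       (map (lookup (extended i)) (x ∷ vs ++ y ∷ []))
  pattern≤extended i =
    subst₂ (Pointwise Bool._≤_) pattern-split path-split
      (end x∉vs class₀⊆X ∷ Pointwise.++⁺ interior (end y∉vs classₑ⊆Y ∷ []))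
    where
    f : ℕ → Bool
    f j = lookup (class (phase j)) i

    end : ∀ {u σ} → u ∉ˡ vs → class σ ⊆ column D u →
          lookup (class σ) i Bool.≤ lookup (extended i) u
    end {u} u∉ ⊆column = Boolₚ.≤-trans (⊆⇒lookup≤ ⊆column i)
      (Boolₚ.≤-reflexive (trans (lookup∘tabulate _ i) (sym (lookup-extended-off i u∉))))

    interior : Pointwise Bool._≤_ (applyUpTo (f ∘ suc) (length vs)) (map (lookup (extended i)) vs)
    interior = Pointwise.map Boolₚ.≤-reflexive (Pointwise.≡⇒Pointwise-≡ (sym
      (trans (map-cong-local (All.tabulate (lookup-extended-on i)))
             (map-position (f ∘ suc) uniq-vs))))

    pattern-split : f 0 ∷ applyUpTo (f ∘ suc) (length vs) ++ f (suc (length vs)) ∷ []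
                  ≡ applyUpTo f (suc (suc (length vs)))
    pattern-split = cong (f 0 ∷_) (applyUpTo-∷ʳ (f ∘ suc) (length vs))

    path-split : lookup (extended i) x ∷ map (lookup (extended i)) vs ++ lookup (extended i) y ∷ []
               ≡ map (lookup (extended i)) (x ∷ vs ++ y ∷ [])
    path-split = cong (lookup (extended i) x ∷_) (sym (map-++ (lookup (extended i)) vs (y ∷ [])))

  dominated-on : ∀ i {u} → u ∈ˡ vs → u ∉ extended i → ∃[ w ] w ∈ extended i × Adj G u w
  dominated-on i = interior-dominated G (extended i) x vs y (proj₂ path)
    (meetsEveryTriple-mono (pattern≤extended i) (applyUpTo-meetsEveryTriple _ (window i) _))

  dominated-off : ∀ i {u} → u ∉ˡ vs → u ∉ extended i → ∃[ w ] w ∈ extended i × Adj G u w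
  dominated-off i {u} u∉vs u∉
    with (w , w∈ , uw) ← proj₂ (proj₁ config i) u (∈-removeVertices⁺ u∉vs)
                                                   (u∉ ∘ ∈-extended-off u∉vs)
    = w , ∈-extended-off (∈-removeVertices⁻ (proj₁ (proj₁ config i) w∈)) w∈ , uw

  extended-dominating : ∀ i → Dominating G ⊤ (extended i)
  extended-dominating i =
    (λ _ → ∈⊤) , λ u _ → [ dominated-on i , dominated-off i ]′ (toSum (u ∈ˡ? vs))

  isConfiguration : IsConfiguration G ⊤ k s extended
  isConfiguration = extended-dominating , multiplicity-extended

lemma10 : (n : ℕ) (G : SimpleGraph n) (x y : Fin n) (vs : List (Fin n)) (r : ℕ) →
    IsBinaryPath G x vs y →
    Σ (Family (2 * r + 1) n) (IsNice G (removeVertices vs) r x y) →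
    HasConfiguration G ⊤ (2 * r + 1) r
lemma10 n G x y vs r (path , _)
        (D , config , ∣X∣≡r , ∣Y∣≡r , (a , x∈Da , y∉Da) , (c , _ , x∉Dc) , (b , x∈Db , y∈Db)) =
  extended , isConfiguration
  where
  cover : PhaseCover r (column D x) (column D y) (phase (suc (length vs)))
  cover = phaseCover ∣X∣≡r ∣Y∣≡r (∈-column⁺ D x∈Da) (∉-column⁺ D y∉Da)
                     (∈-column⁺ D x∈Db) (∈-column⁺ D y∈Db) (∉-column⁺ D x∉Dc)
                     (phase (suc (length vs)))
  open Extension G vs path config cover
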